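{- $\otimes$ [resp. $\mathbin{\text{⅋}}$] is a categorical tensor product (on $\mathbf{Int}$) with neutral element $\mathbf{1}$ [resp. $\bot$].
   Context: An interface $X$ is $(|X|,P_X)$ with $P_X$ a monotonic predicate transformer on $\mathcal{P}(|X|)$; seeds are $x$ with $x\subseteq P_X(x)$. Dual $X^\perp=(|X|,x\mapsto\overline{P_X(\overline{x})})$; tensor $X\otimes Y=(|X|\times|Y|,r\mapsto\bigcup_{x\times y\subseteq r}P_X(x)\times P_Y(y))$; par $X\mathbin{\text{⅋}}Y=(X^\perp\otimes Y^\perp)^\perp$; $X\multimap Y=X^\perp\mathbin{\text{⅋}}Y$; $\mathbf{1}=(\{*\},\mathrm{Id})$, $\bot=\mathbf{1}^\perp$. $\mathbf{Int}$ is the category with interfaces as objects, seeds of $X\multimap Y$ as morphisms $X\to Y$, relational composition and identity relations; on morphisms, tensor acts by $r\otimes r'=\{((a,a'),(b,b'))\mid(a,b)\in r,(a',b')\in r'\}$. -}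

module Defs where

open import Data.Bool using (Bool; true; false; not; _∧_)
open import Data.Unit using (⊤; tt)
open import Data.Empty using (⊥-elim)
open import Data.Product using (Σ; ∃; _×_; _,_; proj₁; proj₂)
open import Relation.Nullary using (Dec; yes; no; ¬_)
open import Relation.Nullary.Decidable using (⌊_⌋)
open import Relation.Binary.PropositionalEquality using (_≡_; refl)

-- Classical metatheory: the paper works classically (complements,
-- double duals, arbitrary unions of subsets).

EM : Set₁
EM = (P : Set) → Dec P

-- Subsets of a set, as characteristic functions (so that P(A) is small).

Subset : Set → Set
Subset A = A → Bool

_∈_ : {A : Set} → A → Subset A → Set
a ∈ x = x a ≡ true

_⊆_ : {A : Set} → Subset A → Subset A → Set
x ⊆ y = ∀ a → a ∈ x → a ∈ y

_≐_ : {A : Set} → Subset A → Subset A → Set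
x ≐ y = x ⊆ y × y ⊆ x

∁ : {A : Set} → Subset A → Subset A
∁ x a = not (x a)

_×ˢ_ : {A B : Set} → Subset A → Subset B → Subset (A × B)
(x ×ˢ y) (a , b) = x a ∧ y b

Monotone : {A : Set} → (Subset A → Subset A) → Set
Monotone {A} P = {x y : Subset A} → x ⊆ y → P x ⊆ P y

record MonoPT (A : Set) : Set where
  constructor mkPT
  field
    apply : Subset A → Subset A
    mono  : Monotone apply

record Interface : Set₁ where
  constructor mkInt
  field
    car : Set
    pt  : MonoPT car
  P : Subset car → Subset car
  P = MonoPT.apply pt

open Interface public

Seed : (X : Interface) → Subset (car X) → Set
Seed X x = x ⊆ P X x

not-anti : {b c : Bool} → (b ≡ true → c ≡ true) → not c ≡ true → not b ≡ true
not-anti {false} f _ = refl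
not-anti {true} {false} f _ = f refl
not-anti {true} {true} f ()

dec-true : {Q : Set} (d : Dec Q) → ⌊ d ⌋ ≡ true → Q
dec-true (yes q) _ = q
dec-true (no _) ()

true-dec : {Q : Set} (d : Dec Q) → Q → ⌊ d ⌋ ≡ true
true-dec (yes _) _ = refl
true-dec (no ¬q) q = ⊥-elim (¬q q)

dualPT : {A : Set} → MonoPT A → MonoPT A
dualPT {A} (mkPT Q m) = mkPT (λ x → ∁ (Q (∁ x))) mono'
  where
  mono' : Monotone (λ x → ∁ (Q (∁ x)))
  mono' {x} {y} s a h =
    not-anti (m {∁ y} {∁ x} (λ b → not-anti (s b)) a) h

_⊥ : Interface → Interface
X ⊥ = mkInt (car X) (dualPT (pt X))

𝟏 : Interface
𝟏 = mkInt ⊤ (mkPT (λ x → x) (λ s → s))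

⊥ᵢ : Interface
⊥ᵢ = 𝟏 ⊥

BinOp : Set₁
BinOp = (X Y : Interface) → MonoPT (car X × (car Y))

opOf : BinOp → Interface → Interface → Interface
opOf op X Y = mkInt (car X × (car Y)) (op X Y)

Rel : Set → Set → Set
Rel A B = Subset (A × B)

_⊠_ : {A B A' B' : Set} → Rel A B → Rel A' B' → Rel (A × A') (B × B')
(r ⊠ r') ((a , a') , (b , b')) = r (a , b) ∧ r' (a' , b')

module Int (em : EM) where

  ⊗PT : BinOp
  ⊗PT X Y = mkPT T mono'
    where
    T : Subset (car X × (car Y)) → Subset (car X × (car Y))
    T r (a , b) = ⌊ em (Σ (Subset (car X)) λ x → Σ (Subset (car Y)) λ y →
                        ((x ×ˢ y) ⊆ r) × (a ∈ P X x) × (b ∈ P Y y)) ⌋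
    mono' : Monotone T
    mono' s (a , b) h with dec-true _ h
    ... | x , y , sub , pa , pb =
      true-dec _ (x , y , (λ p q → s p (sub p q)) , pa , pb)

  _⊗_ : Interface → Interface → Interface
  _⊗_ = opOf ⊗PT

  ⅋PT : BinOp
  ⅋PT X Y = dualPT (⊗PT (X ⊥) (Y ⊥))

  _⅋_ : Interface → Interface → Interface
  _⅋_ = opOf ⅋PT

  _⊸_ : Interface → Interface → Interface
  X ⊸ Y = (X ⊥) ⅋ Y

  IsMor : (X Y : Interface) → Rel (car X) (car Y) → Set
  IsMor X Y r = Seed (X ⊸ Y) r

  idR : (A : Set) → Rel A A
  idR A (a , a') = ⌊ em (a ≡ a') ⌋

  -- relational composition (diagrammatic order: first r, then s)
  infixl 5 _⨾_
  _⨾_ : {A B C : Set} → Rel A B → Rel B C → Rel A C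
  _⨾_ {B = B} r s (a , c) = ⌊ em (Σ B λ b → ((a , b) ∈ r) × ((b , c) ∈ s)) ⌋

  IsIso : (X Y : Interface) → Rel (car X) (car Y) → Set
  IsIso X Y r = IsMor X Y r × Σ (Rel (car Y) (car X)) λ s →
                IsMor Y X s × ((r ⨾ s) ≐ idR (car X)) × ((s ⨾ r) ≐ idR (car Y))

  αR : (A B C : Set) → Rel ((A × B) × C) (A × (B × C))
  αR A B C (((a , b) , c) , (a' , (b' , c'))) = ⌊ em ((a ≡ a') × (b ≡ b') × (c ≡ c')) ⌋

  λR : (U A : Set) → Rel (U × A) A
  λR U A ((_ , a) , a') = ⌊ em (a ≡ a') ⌋

  ρR : (U A : Set) → Rel (A × U) A
  ρR U A ((a , _) , a') = ⌊ em (a ≡ a') ⌋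

  -- "op is a categorical tensor product on Int with neutral element I":
  -- a monoidal structure on Int whose action on morphisms is _⊠_ and whose
  -- associator / unitors are the canonical relations.
  record IsTensorProduct (op : BinOp) (I : Interface) : Set₁ where
    infixl 6 _⊛_
    _⊛_ : Interface → Interface → Interface
    _⊛_ = opOf op
    field
      act-mor : (X X' Y Y' : Interface) (r : Rel (car X) (car Y)) (r' : Rel (car X') (car Y')) →
                IsMor X Y r → IsMor X' Y' r' → IsMor (X ⊛ X') (Y ⊛ Y') (r ⊠ r')
      act-id  : (X Y : Interface) → (idR (car X) ⊠ idR (car Y)) ≐ idR (car (X ⊛ Y))
      act-comp : (X Y Z X' Y' Z' : Interface)
                 (r : Rel (car X) (car Y)) (s : Rel (car Y) (car Z))
                 (r' : Rel (car X') (car Y')) (s' : Rel (car Y') (car Z')) →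
                 IsMor X Y r → IsMor Y Z s → IsMor X' Y' r' → IsMor Y' Z' s' →
                 ((r ⨾ s) ⊠ (r' ⨾ s')) ≐ ((r ⊠ r') ⨾ (s ⊠ s'))
      assoc-iso : (X Y Z : Interface) →
                  IsIso ((X ⊛ Y) ⊛ Z) (X ⊛ (Y ⊛ Z)) (αR (car X) (car Y) (car Z))
      assoc-nat : (X Y Z X' Y' Z' : Interface)
                  (r : Rel (car X) (car X')) (s : Rel (car Y) (car Y')) (t : Rel (car Z) (car Z')) →
                  IsMor X X' r → IsMor Y Y' s → IsMor Z Z' t →
                  (((r ⊠ s) ⊠ t) ⨾ αR (car X') (car Y') (car Z'))
                    ≐ (αR (car X) (car Y) (car Z) ⨾ (r ⊠ (s ⊠ t)))
      unitˡ-iso : (X : Interface) → IsIso (I ⊛ X) X (λR (car I) (car X))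
      unitˡ-nat : (X Y : Interface) (r : Rel (car X) (car Y)) → IsMor X Y r →
                  ((idR (car I) ⊠ r) ⨾ λR (car I) (car Y)) ≐ (λR (car I) (car X) ⨾ r)
      unitʳ-iso : (X : Interface) → IsIso (X ⊛ I) X (ρR (car I) (car X))
      unitʳ-nat : (X Y : Interface) (r : Rel (car X) (car Y)) → IsMor X Y r →
                  ((r ⊠ idR (car I)) ⨾ ρR (car I) (car Y)) ≐ (ρR (car I) (car X) ⨾ r)
      triangle : (X Y : Interface) →
                 (αR (car X) (car I) (car Y) ⨾ (idR (car X) ⊠ λR (car I) (car Y)))
                   ≐ (ρR (car I) (car X) ⊠ idR (car Y))
      pentagon : (W X Y Z : Interface) →
                 ((αR (car W) (car X) (car Y) ⊠ idR (car Z))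
                    ⨾ αR (car W) (car (X ⊛ Y)) (car Z)
                    ⨾ (idR (car W) ⊠ αR (car X) (car Y) (car Z)))
                   ≐ (αR (car (W ⊛ X)) (car Y) (car Z) ⨾ αR (car W) (car X) (car (Y ⊛ Z)))

module Submission where

-- A relation r is a morphism X → Y exactly when it is a simulation: (a , b) ∈ r and
-- a ∈ P_X x imply b ∈ P_Y (r[x]).  Simulations are preserved by ⊗, and taking converses
-- turns a simulation of P by Q into one of Q^⊥ by P^⊥; as the dual of X ⅋ Y is
-- X^⊥ ⊗ Y^⊥, every ⅋-morphism comes from a ⊗-morphism between duals.  The structural
-- maps are graphs of the canonical bijections, simulations in both directions, and the
-- remaining axioms (functoriality, naturality, triangle, pentagon) are identities
-- between relations that hold whatever the interfaces.

open import Data.Bool using (Bool; true; false; not; _∧_)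
open import Data.Bool.Properties using (∧-assoc; ∧-identityʳ)
open import Data.Empty using (⊥-elim)
open import Data.Product using (Σ; _×_; _,_; proj₁; proj₂; map; assocʳ′; assocˡ′)
open import Data.Unit using (⊤; tt)
open import Function using (_∘_; id)
open import Level using (0ℓ)
open import Relation.Binary.Bundles using (Setoid)
open import Relation.Nullary using (¬_)
open import Relation.Nullary.Decidable using (⌊_⌋)
open import Relation.Binary.PropositionalEquality
  using (_≡_; _≗_; refl; sym; trans; cong; cong₂; subst)
import Relation.Binary.Reasoning.Setoid as SetoidReasoning

open import Defs
open MonoPT using (apply; mono)

∧-true⁻ˡ : {b c : Bool} → b ∧ c ≡ true → b ≡ true
∧-true⁻ˡ {true}  _  = refl
∧-true⁻ˡ {false} ()

∧-true⁻ʳ : {b c : Bool} → b ∧ c ≡ true → c ≡ true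
∧-true⁻ʳ {true}  h  = h
∧-true⁻ʳ {false} ()

∧-true⁺ : {b c : Bool} → b ≡ true → c ≡ true → b ∧ c ≡ true
∧-true⁺ refl refl = refl

not-true⁺ : {b : Bool} → ¬ b ≡ true → not b ≡ true
not-true⁺ {false} _ = refl
not-true⁺ {true}  f = ⊥-elim (f refl)

not-true⁻ : {b : Bool} → not b ≡ true → ¬ b ≡ true
not-true⁻ {false} _ ()
not-true⁻ {true}  ()

not-not-true⁺ : {b : Bool} → b ≡ true → not (not b) ≡ true
not-not-true⁺ refl = refl

not-not-true⁻ : {b : Bool} → not (not b) ≡ true → b ≡ true
not-not-true⁻ {true}  _  = refl
not-not-true⁻ {false} ()

true-stable : {b : Bool} → ¬ ¬ b ≡ true → b ≡ true
true-stable {true}  _ = refl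
true-stable {false} f = ⊥-elim (f λ ())

≐-refl : {A : Set} {x : Subset A} → x ≐ x
≐-refl = (λ _ h → h) , (λ _ h → h)

≐-sym : {A : Set} {x y : Subset A} → x ≐ y → y ≐ x
≐-sym (f , g) = g , f

≐-trans : {A : Set} {x y z : Subset A} → x ≐ y → y ≐ z → x ≐ z
≐-trans (f , g) (f' , g') = (λ a h → f' a (f a h)) , (λ a h → g a (g' a h))

≐-pointwise : {A : Set} {x y : Subset A} → (∀ a → x a ≡ y a) → x ≐ y
≐-pointwise e = (λ a h → trans (sym (e a)) h) , (λ a h → trans (e a) h)

≐-setoid : Set → Setoid 0ℓ 0ℓ
≐-setoid A = record
  { Carrier       = Subset A
  ; _≈_           = _≐_
  ; isEquivalence = record { refl = ≐-refl ; sym = ≐-sym ; trans = ≐-trans }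
  }

module ≐-Reasoning {A : Set} = SetoidReasoning (≐-setoid A)

_ᵒ : {A B : Set} → Rel A B → Rel B A
(r ᵒ) (b , a) = r (a , b)

⊠-cong : {A B A' B' : Set} {r s : Rel A B} {r' s' : Rel A' B'} →
  r ≐ s → r' ≐ s' → (r ⊠ r') ≐ (s ⊠ s')
⊠-cong (f , g) (f' , g') =
  (λ { ((a , a') , (b , b')) h → ∧-true⁺ (f _ (∧-true⁻ˡ h)) (f' _ (∧-true⁻ʳ h)) }) ,
  (λ { ((a , a') , (b , b')) h → ∧-true⁺ (g _ (∧-true⁻ˡ h)) (g' _ (∧-true⁻ʳ h)) })

record _≈ᵖ_ {A : Set} (P Q : MonoPT A) : Set where
  constructor mk≈ᵖ
  field ≈ᵖ-apply : ∀ x → apply P x ≐ apply Q x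
open _≈ᵖ_

≈ᵖ-refl : {A : Set} {P : MonoPT A} → P ≈ᵖ P
≈ᵖ-refl = mk≈ᵖ λ _ → ≐-refl

≈ᵖ-sym : {A : Set} {P Q : MonoPT A} → P ≈ᵖ Q → Q ≈ᵖ P
≈ᵖ-sym e = mk≈ᵖ λ x → ≐-sym (≈ᵖ-apply e x)

≈ᵖ-trans : {A : Set} {P Q R : MonoPT A} → P ≈ᵖ Q → Q ≈ᵖ R → P ≈ᵖ R
≈ᵖ-trans e e' = mk≈ᵖ λ x → ≐-trans (≈ᵖ-apply e x) (≈ᵖ-apply e' x)

dualPT-involutive : {A : Set} (P : MonoPT A) → P ≈ᵖ dualPT (dualPT P)
dualPT-involutive P = mk≈ᵖ λ x →
  (λ a h → not-not-true⁺ (mono P (λ _ → not-not-true⁺) a h)) ,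
  (λ a h → mono P (λ _ → not-not-true⁻) a (not-not-true⁻ h))


module Monoidal (em : EM) where
  open Int em

  em-true⁺ : {Q : Set} → Q → ⌊ em Q ⌋ ≡ true
  em-true⁺ = true-dec (em _)

  em-true⁻ : {Q : Set} → ⌊ em Q ⌋ ≡ true → Q
  em-true⁻ = dec-true (em _)

  em-false⁺ : {Q : Set} → ¬ Q → not ⌊ em Q ⌋ ≡ true
  em-false⁺ ¬q = not-true⁺ (λ h → ¬q (em-true⁻ h))

  image : {A B : Set} → Rel A B → Subset A → Subset B
  image {A} r x b = ⌊ em (Σ A λ a → (a ∈ x) × ((a , b) ∈ r)) ⌋

  image-mono : {A B : Set} {r s : Rel A B} → r ⊆ s → ∀ x → image r x ⊆ image s x
  image-mono r⊆s x b h with em-true⁻ h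
  ... | a , a∈x , rab = em-true⁺ (a , a∈x , r⊆s _ rab)

  graph : {A B : Set} → (A → B) → Rel A B
  graph f (a , b) = ⌊ em (f a ≡ b) ⌋

  graph-cong : {A B : Set} {f g : A → B} → f ≗ g → graph f ≐ graph g
  graph-cong e = (λ { (a , b) h → em-true⁺ (trans (sym (e a)) (em-true⁻ h)) }) ,
                 (λ { (a , b) h → em-true⁺ (trans (e a) (em-true⁻ h)) })

  graph-⨾ : {A B C : Set} (f : A → B) (g : B → C) → (graph f ⨾ graph g) ≐ graph (g ∘ f)
  graph-⨾ f g =
    (λ { (a , c) h → let (b , fa≡b , gb≡c) = em-true⁻ h
                     in em-true⁺ (trans (cong g (em-true⁻ fa≡b)) (em-true⁻ gb≡c)) }) ,
    (λ { (a , c) h → em-true⁺ (f a , em-true⁺ refl , h) })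

  graph-⊠ : {A B A' B' : Set} (f : A → B) (g : A' → B') → (graph f ⊠ graph g) ≐ graph (map f g)
  graph-⊠ f g =
    (λ { ((a , a') , (b , b')) h →
           em-true⁺ (cong₂ _,_ (em-true⁻ (∧-true⁻ˡ h))
                               (em-true⁻ (∧-true⁻ʳ {graph f (a , b)} h))) }) ,
    (λ { ((a , a') , (b , b')) h → let e = em-true⁻ h
                                   in ∧-true⁺ (em-true⁺ (cong proj₁ e)) (em-true⁺ (cong proj₂ e)) })

  graph-ᵒ : {A B : Set} (f : A → B) (g : B → A) → g ∘ f ≗ id → f ∘ g ≗ id →
    (graph f ᵒ) ≐ graph g
  graph-ᵒ f g gf fg =
    (λ { (b , a) h → em-true⁺ (trans (cong g (sym (em-true⁻ h))) (gf a)) }) ,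
    (λ { (b , a) h → em-true⁺ (trans (cong f (sym (em-true⁻ h))) (fg b)) })

  graph-⨾ˡ : {A B C : Set} (f : A → B) (s : Rel B C) →
    (graph f ⨾ s) ≐ (λ { (a , c) → s (f a , c) })
  graph-⨾ˡ f s =
    (λ { (a , c) h → let (b , fa≡b , sbc) = em-true⁻ h
                     in subst (λ b → s (b , c) ≡ true) (sym (em-true⁻ fa≡b)) sbc }) ,
    (λ { (a , c) h → em-true⁺ (f a , em-true⁺ refl , h) })

  graph-⨾ʳ : {A B C : Set} (r : Rel A B) (g : B → C) (h : C → B) → h ∘ g ≗ id → g ∘ h ≗ id →
    (r ⨾ graph g) ≐ (λ { (a , c) → r (a , h c) })
  graph-⨾ʳ r g h hg gh =
    (λ { (a , c) q → let (b , rab , gb≡c) = em-true⁻ q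
                     in subst (λ b → r (a , b) ≡ true)
                              (trans (sym (hg b)) (cong h (em-true⁻ gb≡c))) rab }) ,
    (λ { (a , c) q → em-true⁺ (h c , q , em-true⁺ (gh c)) })

  ⨾-cong : {A B C : Set} {r r' : Rel A B} {s s' : Rel B C} →
    r ≐ r' → s ≐ s' → (r ⨾ s) ≐ (r' ⨾ s')
  ⨾-cong (f , g) (f' , g') =
    (λ { (a , c) h → let (b , rab , sbc) = em-true⁻ h in em-true⁺ (b , f _ rab , f' _ sbc) }) ,
    (λ { (a , c) h → let (b , rab , sbc) = em-true⁻ h in em-true⁺ (b , g _ rab , g' _ sbc) })

  αR≐graph : (A B C : Set) → αR A B C ≐ graph assocʳ′
  αR≐graph A B C = to , from
    where
    to : αR A B C ⊆ graph assocʳ′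
    to (((a , b) , c) , (a' , (b' , c'))) h with em-true⁻ h
    ... | refl , refl , refl = em-true⁺ refl
    from : graph assocʳ′ ⊆ αR A B C
    from (((a , b) , c) , (a' , (b' , c'))) h with em-true⁻ h
    ... | refl = em-true⁺ (refl , refl , refl)

  ⊠-idR : (A B : Set) → (idR A ⊠ idR B) ≐ idR (A × B)
  ⊠-idR A B = ≐-trans (graph-⊠ id id) (graph-cong λ _ → refl)

  ⊠-⨾ : {A B C A' B' C' : Set} (r : Rel A B) (s : Rel B C) (r' : Rel A' B') (s' : Rel B' C') →
    ((r ⨾ s) ⊠ (r' ⨾ s')) ≐ ((r ⊠ r') ⨾ (s ⊠ s'))
  ⊠-⨾ r s r' s' =
    (λ { ((a , a') , (c , c')) h →
           let (b , rab , sbc) = em-true⁻ (∧-true⁻ˡ h)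
               (b' , rab' , sbc') = em-true⁻ (∧-true⁻ʳ {(r ⨾ s) (a , c)} h)
           in em-true⁺ ((b , b') , ∧-true⁺ rab rab' , ∧-true⁺ sbc sbc') }) ,
    (λ { ((a , a') , (c , c')) h →
           let ((b , b') , rr , ss) = em-true⁻ h
           in ∧-true⁺ (em-true⁺ (b , ∧-true⁻ˡ rr , ∧-true⁻ˡ ss))
                      (em-true⁺ (b' , ∧-true⁻ʳ {r (a , b)} rr , ∧-true⁻ʳ {s (b , c)} ss)) })

  α-natural : {A B C A' B' C' : Set} (r : Rel A A') (s : Rel B B') (t : Rel C C') →
    (((r ⊠ s) ⊠ t) ⨾ αR A' B' C') ≐ (αR A B C ⨾ (r ⊠ (s ⊠ t)))
  α-natural {A} {B} {C} {A'} {B'} {C'} r s t = begin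
    ((r ⊠ s) ⊠ t) ⨾ αR A' B' C'
      ≈⟨ ⨾-cong ≐-refl (αR≐graph A' B' C') ⟩
    ((r ⊠ s) ⊠ t) ⨾ graph assocʳ′
      ≈⟨ graph-⨾ʳ _ assocʳ′ assocˡ′ (λ _ → refl) (λ _ → refl) ⟩
    (λ { (p , q) → ((r ⊠ s) ⊠ t) (p , assocˡ′ q) })
      ≈⟨ ≐-pointwise (λ { (((a , b) , c) , (a' , (b' , c'))) →
                             ∧-assoc (r (a , a')) (s (b , b')) (t (c , c')) }) ⟩
    (λ { (p , q) → (r ⊠ (s ⊠ t)) (assocʳ′ p , q) })
      ≈⟨ graph-⨾ˡ assocʳ′ _ ⟨
    graph assocʳ′ ⨾ (r ⊠ (s ⊠ t))
      ≈⟨ ⨾-cong (αR≐graph A B C) ≐-refl ⟨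
    αR A B C ⨾ (r ⊠ (s ⊠ t)) ∎
    where open ≐-Reasoning

  λ-natural : {A B : Set} (r : Rel A B) → ((idR ⊤ ⊠ r) ⨾ λR ⊤ B) ≐ (λR ⊤ A ⨾ r)
  λ-natural {A} {B} r = begin
    (idR ⊤ ⊠ r) ⨾ λR ⊤ B
      ≈⟨ graph-⨾ʳ _ proj₂ (tt ,_) (λ _ → refl) (λ _ → refl) ⟩
    (λ { (p , b) → (idR ⊤ ⊠ r) (p , (tt , b)) })
      ≈⟨ ≐-pointwise (λ { ((_ , a) , b) → cong (_∧ r (a , b)) (em-true⁺ refl) }) ⟩
    (λ { (p , b) → r (proj₂ p , b) })
      ≈⟨ graph-⨾ˡ proj₂ r ⟨
    λR ⊤ A ⨾ r ∎
    where open ≐-Reasoning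

  ρ-natural : {A B : Set} (r : Rel A B) → ((r ⊠ idR ⊤) ⨾ ρR ⊤ B) ≐ (ρR ⊤ A ⨾ r)
  ρ-natural {A} {B} r = begin
    (r ⊠ idR ⊤) ⨾ ρR ⊤ B
      ≈⟨ graph-⨾ʳ _ proj₁ (_, tt) (λ _ → refl) (λ _ → refl) ⟩
    (λ { (p , b) → (r ⊠ idR ⊤) (p , (b , tt)) })
      ≈⟨ ≐-pointwise (λ { ((a , _) , b) →
                             trans (cong (r (a , b) ∧_) (em-true⁺ refl)) (∧-identityʳ (r (a , b))) }) ⟩
    (λ { (p , b) → r (proj₁ p , b) })
      ≈⟨ graph-⨾ˡ proj₁ r ⟨
    ρR ⊤ A ⨾ r ∎
    where open ≐-Reasoning

  triangle-rel : (A B : Set) → (αR A ⊤ B ⨾ (idR A ⊠ λR ⊤ B)) ≐ (ρR ⊤ A ⊠ idR B)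
  triangle-rel A B = begin
    αR A ⊤ B ⨾ (idR A ⊠ λR ⊤ B)
      ≈⟨ ⨾-cong (αR≐graph A ⊤ B) (graph-⊠ id proj₂) ⟩
    graph assocʳ′ ⨾ graph (map id proj₂)
      ≈⟨ graph-⨾ _ _ ⟩
    graph (map proj₁ id)
      ≈⟨ graph-⊠ proj₁ id ⟨
    ρR ⊤ A ⊠ idR B ∎
    where open ≐-Reasoning

  pentagon-rel : (W X Y Z : Set) →
    ((αR W X Y ⊠ idR Z) ⨾ αR W (X × Y) Z ⨾ (idR W ⊠ αR X Y Z))
      ≐ (αR (W × X) Y Z ⨾ αR W X (Y × Z))
  pentagon-rel W X Y Z = begin
    (αR W X Y ⊠ idR Z) ⨾ αR W (X × Y) Z ⨾ (idR W ⊠ αR X Y Z)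
      ≈⟨ ⨾-cong (⨾-cong (⊠-cong (αR≐graph W X Y) ≐-refl) (αR≐graph W (X × Y) Z))
                (⊠-cong ≐-refl (αR≐graph X Y Z)) ⟩
    (graph assocʳ′ ⊠ graph id) ⨾ graph assocʳ′ ⨾ (graph id ⊠ graph assocʳ′)
      ≈⟨ ⨾-cong (⨾-cong (graph-⊠ assocʳ′ id) ≐-refl) (graph-⊠ id assocʳ′) ⟩
    graph (map assocʳ′ id) ⨾ graph assocʳ′ ⨾ graph (map id assocʳ′)
      ≈⟨ ≐-trans (⨾-cong (graph-⨾ _ _) ≐-refl) (graph-⨾ _ _) ⟩
    graph (assocʳ′ ∘ assocʳ′)
      ≈⟨ graph-⨾ assocʳ′ assocʳ′ ⟨
    graph assocʳ′ ⨾ graph assocʳ′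
      ≈⟨ ⨾-cong (αR≐graph (W × X) Y Z) (αR≐graph W X (Y × Z)) ⟨
    αR (W × X) Y Z ⨾ αR W X (Y × Z) ∎
    where open ≐-Reasoning

  seed-resp : (X : Interface) {x y : Subset (car X)} → x ≐ y → Seed X x → Seed X y
  seed-resp X (x⊆y , y⊆x) seed a a∈y = mono (pt X) x⊆y a (seed a (y⊆x a a∈y))

  record Simulation {A B : Set} (P : MonoPT A) (Q : MonoPT B) (r : Rel A B) : Set where
    constructor simulation
    field simulate : ∀ a b x → (a , b) ∈ r → a ∈ apply P x → b ∈ apply Q (image r x)
  open Simulation

  isMor⇒simulation : (X Y : Interface) (r : Rel (car X) (car Y)) →
    IsMor X Y r → Simulation (pt X) (pt Y) r
  isMor⇒simulation X Y r seed = simulation λ a b x rab a∈Px →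
    true-stable λ b∉Pr[x] → not-true⁻ (seed (a , b) rab)
      (em-true⁺ (x , ∁ (image r x) , outside-r x ,
                 not-not-true⁺ (mono (pt X) (λ _ → not-not-true⁺) a a∈Px) ,
                 not-true⁺ λ h → b∉Pr[x] (mono (pt Y) (λ _ → not-not-true⁻) b h)))
    where
    -- ∁ (image r x) is the largest y with x ×ˢ y ⊆ ∁ r.
    outside-r : ∀ x → (x ×ˢ ∁ (image r x)) ⊆ ∁ r
    outside-r x (a , b) h =
      not-true⁺ λ rab → not-true⁻ (∧-true⁻ʳ {x a} h) (em-true⁺ (a , ∧-true⁻ˡ h , rab))

  simulation⇒isMor : (X Y : Interface) (r : Rel (car X) (car Y)) →
    Simulation (pt X) (pt Y) r → IsMor X Y r
  simulation⇒isMor X Y r sim (a , b) rab = em-false⁺ λ { (x , y , x×y⊆∁r , a∈Px , b∈P⊥y) →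
    not-true⁻ b∈P⊥y
      (mono (pt Y) (λ b' h → not-true⁺ (disjoint x×y⊆∁r b' h)) b
        (simulate sim a b (∁ (∁ x)) rab (not-not-true⁻ a∈Px))) }
    where
    disjoint : ∀ {x y} → (x ×ˢ y) ⊆ ∁ r → ∀ b' → b' ∈ image r (∁ (∁ x)) → ¬ b' ∈ y
    disjoint x×y⊆∁r b' h b'∈y with em-true⁻ h
    ... | a' , a'∈x , ra'b' =
      not-true⁻ (x×y⊆∁r (a' , b') (∧-true⁺ (not-not-true⁻ a'∈x) b'∈y)) ra'b'

  simulation-resp : {A B : Set} {P P' : MonoPT A} {Q Q' : MonoPT B} {r r' : Rel A B} →
    P ≈ᵖ P' → Q ≈ᵖ Q' → r ≐ r' → Simulation P Q r → Simulation P' Q' r'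
  simulation-resp {Q = Q} {r = r} {r'} P≈P' Q≈Q' (r⊆r' , r'⊆r) sim = simulation λ a b x rab a∈P'x →
    proj₁ (≈ᵖ-apply Q≈Q' (image r' x)) b
      (mono Q (image-mono r⊆r' x) b
        (simulate sim a b x (r'⊆r (a , b) rab) (proj₂ (≈ᵖ-apply P≈P' x) a a∈P'x)))

  simulation-dual : {A B : Set} {P : MonoPT A} {Q : MonoPT B} {r : Rel A B} →
    Simulation P Q r → Simulation (dualPT Q) (dualPT P) (r ᵒ)
  simulation-dual {Q = Q} {r} sim = simulation λ b a y rab b∈Q⊥y →
    not-true⁺ λ a∈P∁ → not-true⁻ b∈Q⊥y
      (mono Q (image-outside y) b (simulate sim a b (∁ (image (r ᵒ) y)) rab a∈P∁))
    where
    image-outside : ∀ y → image r (∁ (image (r ᵒ) y)) ⊆ ∁ y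
    image-outside y b' h with em-true⁻ h
    ... | a' , a'∉ , ra'b' = not-true⁺ λ b'∈y → not-true⁻ a'∉ (em-true⁺ (b' , b'∈y , ra'b'))

  isMor-from-dual : (X Y : Interface) {r : Rel (car X) (car Y)} {s : Rel (car Y) (car X)}
    {P : MonoPT (car Y)} {Q : MonoPT (car X)} →
    P ≈ᵖ dualPT (pt Y) → Q ≈ᵖ dualPT (pt X) → s ≐ (r ᵒ) → Simulation P Q s → IsMor X Y r
  isMor-from-dual X Y {r} P≈ Q≈ s≐rᵒ sim = simulation⇒isMor X Y r
    (simulation-resp (≈ᵖ-sym (dualPT-involutive (pt X))) (≈ᵖ-sym (dualPT-involutive (pt Y))) ≐-refl
      (simulation-dual (simulation-resp P≈ Q≈ s≐rᵒ sim)))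

  ⊗-simulation : (X Y X' Y' : Interface) {r : Rel (car X) (car Y)} {r' : Rel (car X') (car Y')} →
    Simulation (pt X) (pt Y) r → Simulation (pt X') (pt Y') r' →
    Simulation (⊗PT X X') (⊗PT Y Y') (r ⊠ r')
  ⊗-simulation X Y X' Y' {r} {r'} sim sim' = simulation go
    where
    go : ∀ a b w → (a , b) ∈ (r ⊠ r') → a ∈ apply (⊗PT X X') w →
      b ∈ apply (⊗PT Y Y') (image (r ⊠ r') w)
    go (a , a') (b , b') w rr h with em-true⁻ h
    ... | x , x' , x×x'⊆w , a∈Px , a'∈Px' =
      em-true⁺ (image r x , image r' x' , images⊆ , simulate sim a b x (∧-true⁻ˡ rr) a∈Px ,
                simulate sim' a' b' x' (∧-true⁻ʳ rr) a'∈Px')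
      where
      images⊆ : (image r x ×ˢ image r' x') ⊆ image (r ⊠ r') w
      images⊆ (c , c') q with em-true⁻ (∧-true⁻ˡ q) | em-true⁻ (∧-true⁻ʳ {image r x c} q)
      ... | d , d∈x , rdc | d' , d'∈x' , rd'c' =
        em-true⁺ ((d , d') , x×x'⊆w (d , d') (∧-true⁺ d∈x d'∈x') , ∧-true⁺ rdc rd'c')


  ⊗-mono : {A B : Set} {P P' : MonoPT A} {Q Q' : MonoPT B} →
    (∀ x → apply P x ⊆ apply P' x) → (∀ y → apply Q y ⊆ apply Q' y) →
    ∀ w → apply (⊗PT (mkInt A P) (mkInt B Q)) w ⊆ apply (⊗PT (mkInt A P') (mkInt B Q')) w
  ⊗-mono P⊆P' Q⊆Q' w (a , b) h with em-true⁻ h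
  ... | x , y , x×y⊆w , a∈Px , b∈Qy =
    em-true⁺ (x , y , x×y⊆w , P⊆P' x a a∈Px , Q⊆Q' y b b∈Qy)

  ⊗-cong : {A B : Set} {P P' : MonoPT A} {Q Q' : MonoPT B} → P ≈ᵖ P' → Q ≈ᵖ Q' →
    ⊗PT (mkInt A P) (mkInt B Q) ≈ᵖ ⊗PT (mkInt A P') (mkInt B Q')
  ⊗-cong {P = P} {P'} {Q} {Q'} P≈P' Q≈Q' = mk≈ᵖ λ w →
    ⊗-mono {P = P} {P'} {Q} {Q'} (λ x → proj₁ (≈ᵖ-apply P≈P' x))
                                 (λ y → proj₁ (≈ᵖ-apply Q≈Q' y)) w ,
    ⊗-mono {P = P'} {P} {Q'} {Q} (λ x → proj₂ (≈ᵖ-apply P≈P' x))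
                                 (λ y → proj₂ (≈ᵖ-apply Q≈Q' y)) w

  ⊗-dual-⅋ : (X Y : Interface) {P : MonoPT (car X)} {Q : MonoPT (car Y)} →
    P ≈ᵖ dualPT (pt X) → Q ≈ᵖ dualPT (pt Y) →
    ⊗PT (mkInt (car X) P) (mkInt (car Y) Q) ≈ᵖ dualPT (⅋PT X Y)
  ⊗-dual-⅋ X Y P≈ Q≈ = ≈ᵖ-trans (⊗-cong P≈ Q≈) (dualPT-involutive (⊗PT (X ⊥) (Y ⊥)))

  α-simulation : (X Y Z : Interface) →
    Simulation (⊗PT (X ⊗ Y) Z) (⊗PT X (Y ⊗ Z)) (graph assocʳ′)
  α-simulation X Y Z = simulation go
    where
    go : ∀ p q w → (p , q) ∈ graph assocʳ′ → p ∈ apply (⊗PT (X ⊗ Y) Z) w →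
      q ∈ apply (⊗PT X (Y ⊗ Z)) (image (graph assocʳ′) w)
    go ((a , b) , c) q w h p∈ with em-true⁻ h | em-true⁻ p∈
    ... | refl | u , z , u×z⊆w , ab∈Pu , c∈Pz with em-true⁻ ab∈Pu
    ... | x , y , x×y⊆u , a∈Px , b∈Py =
      em-true⁺ (x , y ×ˢ z , reassociated , a∈Px , em-true⁺ (y , z , (λ _ h → h) , b∈Py , c∈Pz))
      where
      reassociated : (x ×ˢ (y ×ˢ z)) ⊆ image (graph assocʳ′) w
      reassociated (a₁ , (b₁ , c₁)) h = em-true⁺ (((a₁ , b₁) , c₁) ,
        u×z⊆w _ (∧-true⁺ (x×y⊆u _ (∧-true⁺ a₁∈x (∧-true⁻ˡ bc∈y×z)))
                         (∧-true⁻ʳ {y b₁} bc∈y×z)) ,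
        em-true⁺ refl)
        where
        a₁∈x : a₁ ∈ x
        a₁∈x = ∧-true⁻ˡ h
        bc∈y×z : (b₁ , c₁) ∈ (y ×ˢ z)
        bc∈y×z = ∧-true⁻ʳ {x a₁} h

  α⁻¹-simulation : (X Y Z : Interface) →
    Simulation (⊗PT X (Y ⊗ Z)) (⊗PT (X ⊗ Y) Z) (graph assocˡ′)
  α⁻¹-simulation X Y Z = simulation go
    where
    go : ∀ p q w → (p , q) ∈ graph assocˡ′ → p ∈ apply (⊗PT X (Y ⊗ Z)) w →
      q ∈ apply (⊗PT (X ⊗ Y) Z) (image (graph assocˡ′) w)
    go (a , (b , c)) q w h p∈ with em-true⁻ h | em-true⁻ p∈
    ... | refl | x , v , x×v⊆w , a∈Px , bc∈Pv with em-true⁻ bc∈Pv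
    ... | y , z , y×z⊆v , b∈Py , c∈Pz =
      em-true⁺ (x ×ˢ y , z , reassociated , em-true⁺ (x , y , (λ _ h → h) , a∈Px , b∈Py) , c∈Pz)
      where
      reassociated : ((x ×ˢ y) ×ˢ z) ⊆ image (graph assocˡ′) w
      reassociated ((a₁ , b₁) , c₁) h = em-true⁺ ((a₁ , (b₁ , c₁)) ,
        x×v⊆w _ (∧-true⁺ (∧-true⁻ˡ ab∈x×y)
                         (y×z⊆v _ (∧-true⁺ (∧-true⁻ʳ {x a₁} ab∈x×y) c₁∈z))) ,
        em-true⁺ refl)
        where
        ab∈x×y : (a₁ , b₁) ∈ (x ×ˢ y)
        ab∈x×y = ∧-true⁻ˡ h
        c₁∈z : c₁ ∈ z
        c₁∈z = ∧-true⁻ʳ {x a₁ ∧ y b₁} h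

  λ-simulation : (X : Interface) → Simulation (⊗PT 𝟏 X) (pt X) (graph proj₂)
  λ-simulation X = simulation go
    where
    go : ∀ p a w → (p , a) ∈ graph proj₂ → p ∈ apply (⊗PT 𝟏 X) w →
      a ∈ apply (pt X) (image (graph proj₂) w)
    go (u , a) a' w h p∈ with em-true⁻ h | em-true⁻ p∈
    ... | refl | _ , x , ⊤×x⊆w , u∈ , a∈Px =
      mono (pt X) (λ c c∈x → em-true⁺ ((u , c) , ⊤×x⊆w _ (∧-true⁺ u∈ c∈x) , em-true⁺ refl)) a a∈Px

  λ⁻¹-simulation : (X : Interface) → Simulation (pt X) (⊗PT 𝟏 X) (graph (tt ,_))
  λ⁻¹-simulation X = simulation go
    where
    go : ∀ a p x → (a , p) ∈ graph (tt ,_) → a ∈ apply (pt X) x →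
      p ∈ apply (⊗PT 𝟏 X) (image (graph (tt ,_)) x)
    go a p x h a∈Px with em-true⁻ h
    ... | refl = em-true⁺ ((λ _ → true) , x ,
                           (λ { (_ , c) c∈x → em-true⁺ (c , c∈x , em-true⁺ refl) }) , refl , a∈Px)

  ρ-simulation : (X : Interface) → Simulation (⊗PT X 𝟏) (pt X) (graph proj₁)
  ρ-simulation X = simulation go
    where
    go : ∀ p a w → (p , a) ∈ graph proj₁ → p ∈ apply (⊗PT X 𝟏) w →
      a ∈ apply (pt X) (image (graph proj₁) w)
    go (a , u) a' w h p∈ with em-true⁻ h | em-true⁻ p∈
    ... | refl | x , _ , x×⊤⊆w , a∈Px , u∈ =
      mono (pt X) (λ c c∈x → em-true⁺ ((c , u) , x×⊤⊆w _ (∧-true⁺ c∈x u∈) , em-true⁺ refl)) a a∈Px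

  ρ⁻¹-simulation : (X : Interface) → Simulation (pt X) (⊗PT X 𝟏) (graph (_, tt))
  ρ⁻¹-simulation X = simulation go
    where
    go : ∀ a p x → (a , p) ∈ graph (_, tt) → a ∈ apply (pt X) x →
      p ∈ apply (⊗PT X 𝟏) (image (graph (_, tt)) x)
    go a p x h a∈Px with em-true⁻ h
    ... | refl = em-true⁺ (x , (λ _ → true) ,
                           (λ { (c , _) h → em-true⁺ (c , ∧-true⁻ˡ h , em-true⁺ refl) }) , a∈Px , refl)

  isIso-graph : (X Y : Interface) {r : Rel (car X) (car Y)} (f : car X → car Y) (g : car Y → car X) →
    g ∘ f ≗ id → f ∘ g ≗ id → r ≐ graph f →
    IsMor X Y (graph f) → IsMor Y X (graph g) → IsIso X Y r
  isIso-graph X Y f g gf fg r≐f f-mor g-mor =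
    seed-resp (X ⊸ Y) (≐-sym r≐f) f-mor , graph g , g-mor ,
    ≐-trans (⨾-cong r≐f ≐-refl) (≐-trans (graph-⨾ f g) (graph-cong gf)) ,
    ≐-trans (⨾-cong ≐-refl r≐f) (≐-trans (graph-⨾ g f) (graph-cong fg))

  isTensorProduct : (op : BinOp) (P₁ : MonoPT ⊤) →
    (∀ X X' Y Y' r r' → IsMor X Y r → IsMor X' Y' r' →
      IsMor (opOf op X X') (opOf op Y Y') (r ⊠ r')) →
    (∀ X Y Z → IsIso (opOf op (opOf op X Y) Z) (opOf op X (opOf op Y Z)) (αR (car X) (car Y) (car Z))) →
    (∀ X → IsIso (opOf op (mkInt ⊤ P₁) X) X (λR ⊤ (car X))) →
    (∀ X → IsIso (opOf op X (mkInt ⊤ P₁)) X (ρR ⊤ (car X))) →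
    IsTensorProduct op (mkInt ⊤ P₁)
  isTensorProduct op P₁ act assoc unitˡ unitʳ = record
    { act-mor   = act
    ; act-id    = λ X Y → ⊠-idR (car X) (car Y)
    ; act-comp  = λ _ _ _ _ _ _ r s r' s' _ _ _ _ → ⊠-⨾ r s r' s'
    ; assoc-iso = assoc
    ; assoc-nat = λ _ _ _ _ _ _ r s t _ _ _ → α-natural r s t
    ; unitˡ-iso = unitˡ
    ; unitˡ-nat = λ _ _ r _ → λ-natural r
    ; unitʳ-iso = unitʳ
    ; unitʳ-nat = λ _ _ r _ → ρ-natural r
    ; triangle  = λ X Y → triangle-rel (car X) (car Y)
    ; pentagon  = λ W X Y Z → pentagon-rel (car W) (car X) (car Y) (car Z)
    }

  ⊗-isTensorProduct : IsTensorProduct ⊗PT 𝟏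
  ⊗-isTensorProduct = isTensorProduct ⊗PT (pt 𝟏) act assoc unitˡ unitʳ
    where
    act : ∀ X X' Y Y' r r' → IsMor X Y r → IsMor X' Y' r' → IsMor (X ⊗ X') (Y ⊗ Y') (r ⊠ r')
    act X X' Y Y' r r' r-mor r'-mor = simulation⇒isMor (X ⊗ X') (Y ⊗ Y') (r ⊠ r')
      (⊗-simulation X Y X' Y' (isMor⇒simulation X Y r r-mor) (isMor⇒simulation X' Y' r' r'-mor))
    assoc : ∀ X Y Z → IsIso ((X ⊗ Y) ⊗ Z) (X ⊗ (Y ⊗ Z)) (αR (car X) (car Y) (car Z))
    assoc X Y Z = isIso-graph ((X ⊗ Y) ⊗ Z) (X ⊗ (Y ⊗ Z)) assocʳ′ assocˡ′
      (λ _ → refl) (λ _ → refl) (αR≐graph _ _ _)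
      (simulation⇒isMor ((X ⊗ Y) ⊗ Z) (X ⊗ (Y ⊗ Z)) _ (α-simulation X Y Z))
      (simulation⇒isMor (X ⊗ (Y ⊗ Z)) ((X ⊗ Y) ⊗ Z) _ (α⁻¹-simulation X Y Z))
    unitˡ : ∀ X → IsIso (𝟏 ⊗ X) X (λR ⊤ (car X))
    unitˡ X = isIso-graph (𝟏 ⊗ X) X proj₂ (tt ,_) (λ _ → refl) (λ _ → refl) ≐-refl
      (simulation⇒isMor (𝟏 ⊗ X) X _ (λ-simulation X))
      (simulation⇒isMor X (𝟏 ⊗ X) _ (λ⁻¹-simulation X))
    unitʳ : ∀ X → IsIso (X ⊗ 𝟏) X (ρR ⊤ (car X))
    unitʳ X = isIso-graph (X ⊗ 𝟏) X proj₁ (_, tt) (λ _ → refl) (λ _ → refl) ≐-refl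
      (simulation⇒isMor (X ⊗ 𝟏) X _ (ρ-simulation X))
      (simulation⇒isMor X (X ⊗ 𝟏) _ (ρ⁻¹-simulation X))

  ⅋-isTensorProduct : IsTensorProduct ⅋PT ⊥ᵢ
  ⅋-isTensorProduct = isTensorProduct ⅋PT (pt ⊥ᵢ) act assoc unitˡ unitʳ
    where
    act : ∀ X X' Y Y' r r' → IsMor X Y r → IsMor X' Y' r' → IsMor (X ⅋ X') (Y ⅋ Y') (r ⊠ r')
    act X X' Y Y' r r' r-mor r'-mor =
      isMor-from-dual (X ⅋ X') (Y ⅋ Y') (dualPT-involutive _) (dualPT-involutive _) ≐-refl
        (⊗-simulation (Y ⊥) (X ⊥) (Y' ⊥) (X' ⊥)
          (simulation-dual (isMor⇒simulation X Y r r-mor))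
          (simulation-dual (isMor⇒simulation X' Y' r' r'-mor)))
    assoc : ∀ X Y Z → IsIso ((X ⅋ Y) ⅋ Z) (X ⅋ (Y ⅋ Z)) (αR (car X) (car Y) (car Z))
    assoc X Y Z = isIso-graph ((X ⅋ Y) ⅋ Z) (X ⅋ (Y ⅋ Z)) assocʳ′ assocˡ′
      (λ _ → refl) (λ _ → refl) (αR≐graph _ _ _)
      (isMor-from-dual ((X ⅋ Y) ⅋ Z) (X ⅋ (Y ⅋ Z)) dual-⅋ʳ dual-⅋ˡ
        (≐-sym (graph-ᵒ assocʳ′ assocˡ′ (λ _ → refl) (λ _ → refl)))
        (α⁻¹-simulation (X ⊥) (Y ⊥) (Z ⊥)))
      (isMor-from-dual (X ⅋ (Y ⅋ Z)) ((X ⅋ Y) ⅋ Z) dual-⅋ˡ dual-⅋ʳ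
        (≐-sym (graph-ᵒ assocˡ′ assocʳ′ (λ _ → refl) (λ _ → refl)))
        (α-simulation (X ⊥) (Y ⊥) (Z ⊥)))
      where
      dual-⅋ʳ : ⊗PT (X ⊥) ((Y ⊥) ⊗ (Z ⊥)) ≈ᵖ dualPT (⅋PT X (Y ⅋ Z))
      dual-⅋ʳ = ⊗-dual-⅋ X (Y ⅋ Z) ≈ᵖ-refl (⊗-dual-⅋ Y Z ≈ᵖ-refl ≈ᵖ-refl)
      dual-⅋ˡ : ⊗PT ((X ⊥) ⊗ (Y ⊥)) (Z ⊥) ≈ᵖ dualPT (⅋PT (X ⅋ Y) Z)
      dual-⅋ˡ = ⊗-dual-⅋ (X ⅋ Y) Z (⊗-dual-⅋ X Y ≈ᵖ-refl ≈ᵖ-refl) ≈ᵖ-refl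
    unitˡ : ∀ X → IsIso (⊥ᵢ ⅋ X) X (λR ⊤ (car X))
    unitˡ X = isIso-graph (⊥ᵢ ⅋ X) X proj₂ (tt ,_) (λ _ → refl) (λ _ → refl) ≐-refl
      (isMor-from-dual (⊥ᵢ ⅋ X) X ≈ᵖ-refl dual-⅋
        (≐-sym (graph-ᵒ proj₂ (tt ,_) (λ _ → refl) (λ _ → refl))) (λ⁻¹-simulation (X ⊥)))
      (isMor-from-dual X (⊥ᵢ ⅋ X) dual-⅋ ≈ᵖ-refl
        (≐-sym (graph-ᵒ (tt ,_) proj₂ (λ _ → refl) (λ _ → refl))) (λ-simulation (X ⊥)))
      where
      dual-⅋ : ⊗PT 𝟏 (X ⊥) ≈ᵖ dualPT (⅋PT ⊥ᵢ X)
      dual-⅋ = ⊗-dual-⅋ ⊥ᵢ X (dualPT-involutive (pt 𝟏)) ≈ᵖ-refl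
    unitʳ : ∀ X → IsIso (X ⅋ ⊥ᵢ) X (ρR ⊤ (car X))
    unitʳ X = isIso-graph (X ⅋ ⊥ᵢ) X proj₁ (_, tt) (λ _ → refl) (λ _ → refl) ≐-refl
      (isMor-from-dual (X ⅋ ⊥ᵢ) X ≈ᵖ-refl dual-⅋
        (≐-sym (graph-ᵒ proj₁ (_, tt) (λ _ → refl) (λ _ → refl))) (ρ⁻¹-simulation (X ⊥)))
      (isMor-from-dual X (X ⅋ ⊥ᵢ) dual-⅋ ≈ᵖ-refl
        (≐-sym (graph-ᵒ (_, tt) proj₁ (λ _ → refl) (λ _ → refl))) (ρ-simulation (X ⊥)))
      where
      dual-⅋ : ⊗PT (X ⊥) 𝟏 ≈ᵖ dualPT (⅋PT X ⊥ᵢ)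
      dual-⅋ = ⊗-dual-⅋ X ⊥ᵢ ≈ᵖ-refl (dualPT-involutive (pt 𝟏))

lemma11 : (em : EM) →
    Int.IsTensorProduct em (Int.⊗PT em) 𝟏 × Int.IsTensorProduct em (Int.⅋PT em) ⊥ᵢ
lemma11 em = ⊗-isTensorProduct , ⅋-isTensorProduct
  where open Monoidal em
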